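{- Let $k\ge 3$ and $\lambda\ge 1$ be integers. If $G$ is an extremal $egr(n,k,4,\lambda)$ graph, then $$n=n(k,4,\lambda)\ge\frac{k^3-2k^2+2k-1+\lambda}{\lambda+k-1}.$$ If $G$ is an extremal bipartite $egr(n,k,4,\lambda)$ graph, then $$n=n_2(k,4,\lambda)\ge\frac{2(k^3-2k^2+2k-1+\lambda)}{\lambda+k-1}.$$
   Context: All graphs are finite and simple; throughout, the degree $k$ satisfies $k>2$. A graph is an $egr(n,k,g,\lambda)$ (edge-girth-regular graph) if it is $k$-regular, has $n$ vertices, has girth $g$, and every edge lies in exactly $\lambda$ distinct cycles of length $g$. An $egr(n,k,g,\lambda)$ is extremal if $n$ is the smallest order of any $egr(n,k,g,\lambda)$; this smallest order is denoted $n(k,g,\lambda)$. A bipartite $egr(n,k,g,\lambda)$ is extremal bipartite if $n$ is the smallest order of a bipartite $egr(n,k,g,\lambda)$; this order is denoted $n_2(k,g,\lambda)$. -}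

module Defs where

open import Data.Nat using (ℕ; zero; suc; _+_; _*_; _≤_; _<_)
open import Data.Bool using (Bool; true; false; _∧_; _∨_; not; if_then_else_)
open import Data.Fin using (Fin; _≟_)
open import Data.List using (List; []; _∷_; map; concatMap; allFin; foldr)
open import Data.Vec using (Vec; toList)
import Data.Vec as V
open import Data.Product using (Σ; _×_; _,_)
open import Relation.Nullary using (¬_)
open import Relation.Nullary.Decidable using (⌊_⌋)
open import Relation.Binary.PropositionalEquality using (_≡_; _≢_)

record Graph (n : ℕ) : Set where
  field
    adj    : Fin n → Fin n → Bool
    sym    : ∀ i j → adj i j ≡ adj j i
    irrefl : ∀ i → adj i i ≡ false
open Graph public

Edge : ∀ {n} → Graph n → Fin n → Fin n → Set
Edge G u v = adj G u v ≡ true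

countB : ∀ {A : Set} → (A → Bool) → List A → ℕ
countB p []       = 0
countB p (x ∷ xs) = if p x then suc (countB p xs) else countB p xs

degree : ∀ {n} → Graph n → Fin n → ℕ
degree {n} G v = countB (adj G v) (allFin n)

Regular : ∀ {n} → Graph n → ℕ → Set
Regular G k = ∀ v → degree G v ≡ k

_==_ : ∀ {n} → Fin n → Fin n → Bool
i == j = ⌊ i ≟ j ⌋

allB : ∀ {A : Set} → (A → Bool) → List A → Bool
allB p = foldr (λ x b → p x ∧ b) true

anyB : ∀ {A : Set} → (A → Bool) → List A → Bool
anyB p = foldr (λ x b → p x ∨ b) false

allDistinct : ∀ {n} → List (Fin n) → Bool
allDistinct []       = true
allDistinct (x ∷ xs) = allB (λ y → not (x == y)) xs ∧ allDistinct xs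

cyclicPairs : ∀ {A : Set} → List A → List (A × A)
cyclicPairs {A} []       = []
cyclicPairs {A} (x ∷ xs) = go (x ∷ xs)
  where
  go : List A → List (A × A)
  go []            = []
  go (a ∷ [])      = (a , x) ∷ []
  go (a ∷ b ∷ rest) = (a , b) ∷ go (b ∷ rest)

-- A labelled cycle: a sequence of m pairwise distinct vertices with
-- cyclically consecutive vertices adjacent.  (m ≥ 3 is imposed separately.)
isCycleB : ∀ {n m} → Graph n → Vec (Fin n) m → Bool
isCycleB G c = allDistinct (toList c)
             ∧ allB (λ { (a , b) → adj G a b }) (cyclicPairs (toList c))

HasCycle : ∀ {n} → Graph n → ℕ → Set
HasCycle {n} G m = 3 ≤ m × Σ (Vec (Fin n) m) (λ c → isCycleB G c ≡ true)

Girth : ∀ {n} → Graph n → ℕ → Set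
Girth G g = HasCycle G g × (∀ m → m < g → ¬ HasCycle G m)

allVecs : (n m : ℕ) → List (Vec (Fin n) m)
allVecs n zero    = V.[] ∷ []
allVecs n (suc m) = concatMap (λ c → map (λ x → x V.∷ c) (allFin n)) (allVecs n m)

usesEdge : ∀ {n m} → Vec (Fin n) m → Fin n → Fin n → Bool
usesEdge c u v = anyB (λ { (a , b) → ((a == u) ∧ (b == v)) ∨ ((a == v) ∧ (b == u)) })
                      (cyclicPairs (toList c))

-- Every (unlabelled) cycle of length m ≥ 3 has exactly 2m labellings
-- (m rotations × 2 directions), so this equals 2m times the number of
-- distinct m-cycles containing {u,v}.
labelledCyclesThrough : ∀ {n} → Graph n → (m : ℕ) → Fin n → Fin n → ℕ
labelledCyclesThrough {n} G m u v =
  countB (λ c → isCycleB G c ∧ usesEdge c u v) (allVecs n m)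

EdgeInCycles : ∀ {n} → Graph n → ℕ → ℕ → Set
EdgeInCycles G g l = ∀ u v → Edge G u v → labelledCyclesThrough G g u v ≡ 2 * g * l

IsEGR : ∀ {n} → Graph n → ℕ → ℕ → ℕ → Set
IsEGR G k g l = Regular G k × Girth G g × EdgeInCycles G g l

IsBipartite : ∀ {n} → Graph n → Set
IsBipartite {n} G = Σ (Fin n → Bool) (λ col → ∀ u v → Edge G u v → col u ≢ col v)

IsExtremalEGR : ∀ {n} → Graph n → ℕ → ℕ → ℕ → Set
IsExtremalEGR {n} G k g l =
  IsEGR G k g l × (∀ m (H : Graph m) → IsEGR H k g l → n ≤ m)

IsExtremalBipEGR : ∀ {n} → Graph n → ℕ → ℕ → ℕ → Set
IsExtremalBipEGR {n} G k g l =
  (IsBipartite G × IsEGR G k g l)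
  × (∀ m (H : Graph m) → IsBipartite H → IsEGR H k g l → n ≤ m)

{-# OPTIONS --safe #-}
module Submission where

-- Fix a vertex v and let c(w) count the paths v–x–w with w ≠ v, so that ∑ c(w) = k(k − 1).
-- Two distinct such paths to the same w close a 4-cycle through an edge vx, and every edge
-- lies in exactly λ of those, whence ∑ c(w)² ≤ ∑ c(w) + kλ = k(k − 1 + λ).  By Cauchy–Schwarz
-- over the m vertices w ≠ v on which c can be nonzero, k²(k − 1)² ≤ m·k(k − 1 + λ), and
-- n ≥ m + 1 gives the first bound.  In the bipartite case the argument is applied to both
-- ends of an edge, with m counting only the vertices of the respective colour class.


open import Defs hiding (sym)
open import Data.Nat using (ℕ; zero; suc; _+_; _*_; _≤_; z≤n; s≤s)
open import Data.Nat.Properties hiding (_≟_)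
open import Data.Nat.Tactic.RingSolver using (solve-∀)
import Data.Nat.ListAction as List
import Data.Nat.ListAction.Properties as List
open import Data.Bool using (Bool; true; false; _∧_; _∨_; not; _xor_)
open import Data.Fin using (Fin; zero; suc; _≟_)
open import Data.Fin.Patterns using (0F; 1F; 2F; 3F; 4F; 5F; 6F; 7F)
open import Data.Bool.Properties using (∨-zeroʳ)
open import Data.List using (List; []; _∷_; map; concatMap; tabulate; allFin; _++_)
open import Data.List.Properties using (map-++; map-cong; map-tabulate)
open import Data.Vec using (Vec) renaming ([] to []ᵛ; _∷_ to _∷ᵛ_)
open import Data.Vec.Functional using (Vector)
open import Data.Product using (_×_; _,_; proj₁; proj₂)
open import Data.List.Relation.Unary.All using (All; []; _∷_)
open import Function using (_∘_; case_of_)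
open import Relation.Nullary using (¬_; yes; no; contradiction)
open import Relation.Nullary.Decidable using (isYes≗does; dec-true; dec-false)
open import Relation.Binary.PropositionalEquality
open import Algebra.Properties.Semiring.Sum +-*-semiring
  using (sum; sum-syntax; sum-cong-≗; sum-replicate-zero; ∑-distrib-+; ∑-comm; *-distribˡ-sum; *-distribʳ-sum)

⟦_⟧ : Bool → ℕ
⟦ true ⟧  = 1
⟦ false ⟧ = 0

⟦⟧≤1 : ∀ b → ⟦ b ⟧ ≤ 1
⟦⟧≤1 true  = s≤s z≤n
⟦⟧≤1 false = z≤n

⟦∧⟧ : ∀ p q → ⟦ p ∧ q ⟧ ≡ ⟦ p ⟧ * ⟦ q ⟧
⟦∧⟧ true  q = sym (+-identityʳ ⟦ q ⟧)
⟦∧⟧ false q = refl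

⟦⟧-mono : ∀ {p q} → (p ≡ true → q ≡ true) → ⟦ p ⟧ ≤ ⟦ q ⟧
⟦⟧-mono {false} _   = z≤n
⟦⟧-mono {true}  p⇒q rewrite p⇒q refl = s≤s z≤n

⟦⟧-split : ∀ p q → ⟦ p ⟧ ≡ ⟦ p ∧ not q ⟧ + ⟦ q ⟧ * ⟦ p ⟧
⟦⟧-split true  true  = refl
⟦⟧-split true  false = refl
⟦⟧-split false true  = refl
⟦⟧-split false false = refl

==-refl : ∀ {n} (x : Fin n) → (x == x) ≡ true
==-refl x = trans (isYes≗does (x ≟ x)) (dec-true (x ≟ x) refl)

==-false : ∀ {n} {x y : Fin n} → ¬ x ≡ y → (x == y) ≡ false
==-false {x = x} {y} x≢y = trans (isYes≗does (x ≟ y)) (dec-false (x ≟ y) x≢y)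

suc-== : ∀ {n} (x y : Fin n) → (Fin.suc x == suc y) ≡ (x == y)
suc-== x y with x ≟ y
... | yes _ = refl
... | no _  = refl

sum-mono-≤ : ∀ {n} {f g : Vector ℕ n} → (∀ i → f i ≤ g i) → sum f ≤ sum g
sum-mono-≤ {zero}  f≤g = z≤n
sum-mono-≤ {suc n} f≤g = +-mono-≤ (f≤g zero) (sum-mono-≤ (f≤g ∘ suc))

≤-sum : ∀ {n} (f : Vector ℕ n) i → f i ≤ sum f
≤-sum f zero    = m≤m+n (f zero) _
≤-sum f (suc i) = ≤-trans (≤-sum (f ∘ suc) i) (m≤n+m _ (f zero))

sum-zero² : ∀ m n → ∑[ i < m ] ∑[ j < n ] 0 ≡ 0
sum-zero² m n = trans (sum-cong-≗ {m} {λ _ → ∑[ j < n ] 0} (λ _ → sum-replicate-zero n)) (sum-replicate-zero m)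

sum-ones : ∀ n → ∑[ i < n ] 1 ≡ n
sum-ones zero    = refl
sum-ones (suc n) = cong suc (sum-ones n)

sum-at : ∀ {n} (f : Vector ℕ n) v → ∑[ w < n ] (⟦ w == v ⟧ * f w) ≡ f v
sum-at {suc n} f zero =
  trans (cong (f zero + 0 +_) (sum-replicate-zero n)) (trans (+-identityʳ _) (+-identityʳ _))
sum-at {suc n} f (suc v) =
  trans (sum-cong-≗ (λ w → cong (λ b → ⟦ b ⟧ * f (suc w)) (suc-== w v))) (sum-at (f ∘ suc) v)

listSum-tabulate : ∀ {n} (f : Vector ℕ n) → List.sum (tabulate f) ≡ sum f
listSum-tabulate {zero}  f = refl
listSum-tabulate {suc n} f = cong (f zero +_) (listSum-tabulate (f ∘ suc))

listSum-map-concatMap : ∀ {A B : Set} (g : B → ℕ) (h : A → List B) xs →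
  List.sum (map g (concatMap h xs)) ≡ List.sum (map (λ x → List.sum (map g (h x))) xs)
listSum-map-concatMap g h []       = refl
listSum-map-concatMap g h (x ∷ xs) = begin
  List.sum (map g (h x ++ concatMap h xs))
    ≡⟨ cong List.sum (map-++ g (h x) (concatMap h xs)) ⟩
  List.sum (map g (h x) ++ map g (concatMap h xs))
    ≡⟨ List.sum-++ (map g (h x)) _ ⟩
  List.sum (map g (h x)) + List.sum (map g (concatMap h xs))
    ≡⟨ cong (List.sum (map g (h x)) +_) (listSum-map-concatMap g h xs) ⟩
  List.sum (map g (h x)) + List.sum (map (λ y → List.sum (map g (h y))) xs) ∎
  where open ≡-Reasoning

countB-listSum : ∀ {A : Set} (p : A → Bool) xs → countB p xs ≡ List.sum (map (⟦_⟧ ∘ p) xs)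
countB-listSum p []       = refl
countB-listSum p (x ∷ xs) with p x
... | true  = cong suc (countB-listSum p xs)
... | false = countB-listSum p xs

∑ⱽ : ∀ {n} m → (Vec (Fin n) m → ℕ) → ℕ
∑ⱽ zero        g = g []ᵛ
∑ⱽ {n} (suc m) g = ∑ⱽ m (λ c → ∑[ x < n ] g (x ∷ᵛ c))

listSum-allVecs : ∀ n m (g : Vec (Fin n) m → ℕ) → List.sum (map g (allVecs n m)) ≡ ∑ⱽ m g
listSum-allVecs n zero    g = +-identityʳ (g []ᵛ)
listSum-allVecs n (suc m) g = begin
  List.sum (map g (allVecs n (suc m)))
    ≡⟨ listSum-map-concatMap g (λ c → map (_∷ᵛ c) (allFin n)) (allVecs n m) ⟩
  List.sum (map (λ c → List.sum (map g (map (_∷ᵛ c) (allFin n)))) (allVecs n m))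
    ≡⟨ cong List.sum (map-cong row (allVecs n m)) ⟩
  List.sum (map (λ c → ∑[ x < n ] g (x ∷ᵛ c)) (allVecs n m))
    ≡⟨ listSum-allVecs n m _ ⟩
  ∑ⱽ (suc m) g ∎
  where
  open ≡-Reasoning
  row : ∀ c → List.sum (map g (map (_∷ᵛ c) (allFin n))) ≡ ∑[ x < n ] g (x ∷ᵛ c)
  row c = trans (cong (List.sum ∘ map g) (map-tabulate (λ x → x) (_∷ᵛ c)))
         (trans (cong List.sum (map-tabulate (_∷ᵛ c) g)) (listSum-tabulate (λ x → g (x ∷ᵛ c))))

countB-allFin : ∀ {n} (p : Fin n → Bool) → countB p (allFin n) ≡ ∑[ x < n ] ⟦ p x ⟧
countB-allFin {n} p = trans (countB-listSum p (allFin n))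
  (trans (cong List.sum (map-tabulate (λ x → x) (⟦_⟧ ∘ p))) (listSum-tabulate (⟦_⟧ ∘ p)))

countB-allVecs : ∀ n m (p : Vec (Fin n) m → Bool) → countB p (allVecs n m) ≡ ∑ⱽ m (⟦_⟧ ∘ p)
countB-allVecs n m p = trans (countB-listSum p (allVecs n m)) (listSum-allVecs n m (⟦_⟧ ∘ p))

am-gm : ∀ x y → 2 * x * y ≤ x * x + y * y
am-gm zero    y       = z≤n
am-gm (suc x) zero    rewrite *-zeroʳ (2 * suc x) = z≤n
am-gm (suc x) (suc y) = subst₂ _≤_ (sym (lhs x y)) (sym (rhs x y)) (+-monoˡ-≤ (2 * x + 2 * y + 2) (am-gm x y))
  where
  lhs : ∀ x y → 2 * suc x * suc y ≡ 2 * x * y + (2 * x + 2 * y + 2)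
  lhs = solve-∀
  rhs : ∀ x y → suc x * suc x + suc y * suc y ≡ (x * x + y * y) + (2 * x + 2 * y + 2)
  rhs = solve-∀

Supported : ∀ {n} → Vector ℕ n → Vector Bool n → Set
Supported a b = ∀ i → b i ≡ false → a i ≡ 0

cross-term-≤ : ∀ {n} (a : Vector ℕ n) (b : Vector Bool n) → Supported a b →
  ∀ x → 2 * x * sum a ≤ ∑[ i < n ] (a i * a i) + ∑[ i < n ] ⟦ b i ⟧ * (x * x)
cross-term-≤ {n} a b a⊆b x = begin
    2 * x * sum a                                          ≡⟨ *-distribˡ-sum (2 * x) a ⟩
    ∑[ i < n ] (2 * x * a i)                               ≤⟨ sum-mono-≤ termwise ⟩
    ∑[ i < n ] (a i * a i + ⟦ b i ⟧ * (x * x))             ≡⟨ ∑-distrib-+ (λ i → a i * a i) _ ⟩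
    ∑[ i < n ] (a i * a i) + ∑[ i < n ] (⟦ b i ⟧ * (x * x)) ≡⟨ cong (_ +_) (*-distribʳ-sum (x * x) (⟦_⟧ ∘ b)) ⟨
    ∑[ i < n ] (a i * a i) + ∑[ i < n ] ⟦ b i ⟧ * (x * x)  ∎
  where
  open ≤-Reasoning
  termwise : ∀ i → 2 * x * a i ≤ a i * a i + ⟦ b i ⟧ * (x * x)
  termwise i with b i in bᵢ
  ... | true  = subst (2 * x * a i ≤_) (trans (+-comm (x * x) _) (cong (a i * a i +_) (sym (*-identityˡ (x * x)))))
                  (am-gm x (a i))
  ... | false rewrite a⊆b i bᵢ | *-zeroʳ (2 * x) = z≤n

cauchy-schwarz : ∀ {n} (a : Vector ℕ n) (b : Vector Bool n) → Supported a b →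
  sum a * sum a ≤ ∑[ i < n ] ⟦ b i ⟧ * ∑[ i < n ] (a i * a i)
cauchy-schwarz {zero}  a b a⊆b = z≤n
cauchy-schwarz {suc n} a b a⊆b with b zero in b₀
... | false rewrite a⊆b zero b₀ = cauchy-schwarz (a ∘ suc) (b ∘ suc) (a⊆b ∘ suc)
... | true  = subst₂ _≤_ (sym (square a₀ A)) (sym (expand a₀ B Q))
  (+-monoʳ-≤ (a₀ * a₀) (+-mono-≤ (cross-term-≤ (a ∘ suc) (b ∘ suc) (a⊆b ∘ suc) a₀)
                                 (cauchy-schwarz (a ∘ suc) (b ∘ suc) (a⊆b ∘ suc))))
  where
  a₀ = a zero
  A  = sum (a ∘ suc)
  B  = ∑[ i < n ] ⟦ b (suc i) ⟧
  Q  = ∑[ i < n ] (a (suc i) * a (suc i))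
  square : ∀ a₀ A → (a₀ + A) * (a₀ + A) ≡ a₀ * a₀ + (2 * a₀ * A + A * A)
  square = solve-∀
  expand : ∀ a₀ B Q → suc B * (a₀ * a₀ + Q) ≡ a₀ * a₀ + ((Q + B * (a₀ * a₀)) + B * Q)
  expand = solve-∀

∧-true : ∀ {p q} → p ∧ q ≡ true → p ≡ true × q ≡ true
∧-true {true} q = refl , q

allB-true : ∀ {A : Set} (p : A → Bool) xs → allB p xs ≡ true → All (λ x → p x ≡ true) xs
allB-true p []       _ = []
allB-true p (x ∷ xs) h = proj₁ (∧-true h) ∷ allB-true p xs (proj₂ (∧-true h))

true-allB : ∀ {A : Set} (p : A → Bool) {xs} → All (λ x → p x ≡ true) xs → allB p xs ≡ true
true-allB p []       = refl
true-allB p (h ∷ hs) = cong₂ _∧_ h (true-allB p hs)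

≢⇒not-== : ∀ {n} {x y : Fin n} → ¬ x ≡ y → not (x == y) ≡ true
≢⇒not-== x≢y = cong not (==-false x≢y)

not-==⇒≢ : ∀ {n} {x y : Fin n} → not (x == y) ≡ true → ¬ x ≡ y
not-==⇒≢ {x = x} h refl rewrite ==-refl x = case h of λ ()

sum-split-at : ∀ {n} (p : Vector Bool n) v → ∑[ w < n ] ⟦ p w ⟧ ≡ ∑[ w < n ] ⟦ p w ∧ not (w == v) ⟧ + ⟦ p v ⟧
sum-split-at {n} p v = begin
  ∑[ w < n ] ⟦ p w ⟧
    ≡⟨ sum-cong-≗ (λ w → ⟦⟧-split (p w) (w == v)) ⟩
  ∑[ w < n ] (⟦ p w ∧ not (w == v) ⟧ + ⟦ w == v ⟧ * ⟦ p w ⟧)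
    ≡⟨ ∑-distrib-+ (λ w → ⟦ p w ∧ not (w == v) ⟧) _ ⟩
  ∑[ w < n ] ⟦ p w ∧ not (w == v) ⟧ + ∑[ w < n ] (⟦ w == v ⟧ * ⟦ p w ⟧)
    ≡⟨ cong (∑[ w < n ] ⟦ p w ∧ not (w == v) ⟧ +_) (sum-at (⟦_⟧ ∘ p) v) ⟩
  ∑[ w < n ] ⟦ p w ∧ not (w == v) ⟧ + ⟦ p v ⟧ ∎
  where open ≡-Reasoning

⟦⟧*⟦⟧-≤ : ∀ p q {m} → (p ≡ true → q ≡ true → 1 ≤ m) → ⟦ p ⟧ * ⟦ q ⟧ ≤ m
⟦⟧*⟦⟧-≤ true  true  h = h refl refl
⟦⟧*⟦⟧-≤ true  false h = z≤n
⟦⟧*⟦⟧-≤ false q     h = z≤n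

at-most-one-≤-any : ∀ {m} (p : Vector Bool m) u → (∀ i → p i ≡ true → u ≡ true) →
  ∑[ i < m ] ⟦ p i ⟧ ≤ 1 → ∑[ i < m ] ⟦ p i ⟧ ≤ ⟦ u ⟧
at-most-one-≤-any p true  _   ≤1 = ≤1
at-most-one-≤-any {m} p false p⇒u _ =
  ≤-trans (sum-mono-≤ (λ i → ⟦⟧-mono (p⇒u i))) (≤-reflexive (sum-replicate-zero m))

∑⁴ : ∀ {n} → (Fin n → Fin n → Fin n → Fin n → ℕ) → ℕ
∑⁴ {n} g = ∑[ d < n ] ∑[ c < n ] ∑[ b < n ] ∑[ a < n ] g a b c d

∑⁴-mono-≤ : ∀ {n} {g h : Fin n → Fin n → Fin n → Fin n → ℕ} →
  (∀ a b c d → g a b c d ≤ h a b c d) → ∑⁴ g ≤ ∑⁴ h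
∑⁴-mono-≤ g≤h = sum-mono-≤ λ d → sum-mono-≤ λ c → sum-mono-≤ λ b → sum-mono-≤ λ a → g≤h a b c d

∑-∑⁴-comm : ∀ {m n} (g : Fin m → Fin n → Fin n → Fin n → Fin n → ℕ) →
  ∑[ i < m ] ∑⁴ (g i) ≡ ∑⁴ (λ a b c d → ∑[ i < m ] g i a b c d)
∑-∑⁴-comm g =
  trans (∑-comm λ i d → ∑[ c < _ ] ∑[ b < _ ] ∑[ a < _ ] g i a b c d) (sum-cong-≗ λ d →
  trans (∑-comm λ i c → ∑[ b < _ ] ∑[ a < _ ] g i a b c d) (sum-cong-≗ λ c →
  trans (∑-comm λ i b → ∑[ a < _ ] g i a b c d) (sum-cong-≗ λ b →
  ∑-comm λ i a → g i a b c d)))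

module _ {n} (g : Fin n → Fin n → Fin n → Fin n → ℕ) (s t : Fin n) where

  pick-ab : ∑[ d < n ] ∑[ c < n ] g s t c d ≤ ∑⁴ g
  pick-ab = sum-mono-≤ λ d → sum-mono-≤ λ c →
    ≤-trans (≤-sum (λ a → g a t c d) s) (≤-sum (λ b → ∑[ a < n ] g a b c d) t)

  pick-bc : ∑[ d < n ] ∑[ a < n ] g a s t d ≤ ∑⁴ g
  pick-bc = sum-mono-≤ λ d →
    ≤-trans (≤-sum (λ b → ∑[ a < n ] g a b t d) s) (≤-sum (λ c → ∑[ b < n ] ∑[ a < n ] g a b c d) t)

  pick-cd : ∑[ b < n ] ∑[ a < n ] g a b s t ≤ ∑⁴ g
  pick-cd = ≤-trans (≤-sum (λ c → ∑[ b < n ] ∑[ a < n ] g a b c t) s)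
                    (≤-sum (λ d → ∑[ c < n ] ∑[ b < n ] ∑[ a < n ] g a b c d) t)

  pick-da : ∑[ c < n ] ∑[ b < n ] g t b c s ≤ ∑⁴ g
  pick-da = ≤-trans (sum-mono-≤ λ c → sum-mono-≤ λ b → ≤-sum (λ a → g a b c s) t)
                    (≤-sum (λ d → ∑[ c < n ] ∑[ b < n ] ∑[ a < n ] g a b c d) s)

eight-products-≤ : ∀ ea eb ec ed fa fb fc fd →
  ea * fb + (fa * eb + (eb * fc + (fb * ec + (ec * fd + (fc * ed + (ed * fa + (fd * ea + 0)))))))
    ≤ (ea + (eb + (ec + ed))) * (fa + (fb + (fc + fd)))
eight-products-≤ ea eb ec ed fa fb fc fd = ≤-trans (m≤m+n _ _) (≤-reflexive (sym (expand ea eb ec ed fa fb fc fd)))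
  where
  expand : ∀ ea eb ec ed fa fb fc fd →
    (ea + (eb + (ec + ed))) * (fa + (fb + (fc + fd)))
      ≡ (ea * fb + (fa * eb + (eb * fc + (fb * ec + (ec * fd + (fc * ed + (ed * fa + (fd * ea + 0))))))))
        + (ea * fa + ea * fc + eb * fb + eb * fd + ec * fa + ec * fc + ed * fb + ed * fd)
  expand = solve-∀

at : ∀ {n} → Fin n → Fin n → Fin n → Fin n → Bool
at s t y z = (y == s) ∧ (z == t)

-- The eight slots an edge {v, x} can occupy in a labelled 4-cycle a b c d, in the order of usesEdge.
position : ∀ {n} → Fin n → Fin n → Fin 8 → Fin n → Fin n → Fin n → Fin n → Bool
position v x 0F a b c d = at v x a b
position v x 1F a b c d = at x v a b
position v x 2F a b c d = at v x b c
position v x 3F a b c d = at x v b c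
position v x 4F a b c d = at v x c d
position v x 5F a b c d = at x v c d
position v x 6F a b c d = at v x d a
position v x 7F a b c d = at x v d a

position⇒usesEdge : ∀ {n} (v x : Fin n) i {a b c d} →
  position v x i a b c d ≡ true → usesEdge (a ∷ᵛ b ∷ᵛ c ∷ᵛ d ∷ᵛ []ᵛ) v x ≡ true
position⇒usesEdge v x 0F h rewrite h = refl
position⇒usesEdge v x 1F {a} {b} h rewrite h | ∨-zeroʳ (at v x a b) = refl
position⇒usesEdge v x 2F {a} {b} h rewrite h = ∨-zeroʳ (at v x a b ∨ at x v a b)
position⇒usesEdge v x 3F {a} {b} {c} h rewrite h | ∨-zeroʳ (at v x b c) = ∨-zeroʳ (at v x a b ∨ at x v a b)
position⇒usesEdge v x 4F {a} {b} {c} h rewrite h | ∨-zeroʳ (at v x b c ∨ at x v b c) = ∨-zeroʳ (at v x a b ∨ at x v a b)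
position⇒usesEdge v x 5F {a} {b} {c} {d} h
  rewrite h | ∨-zeroʳ (at v x c d) | ∨-zeroʳ (at v x b c ∨ at x v b c) = ∨-zeroʳ (at v x a b ∨ at x v a b)
position⇒usesEdge v x 6F {a} {b} {c} {d} h
  rewrite h | ∨-zeroʳ (at v x c d ∨ at x v c d) | ∨-zeroʳ (at v x b c ∨ at x v b c) = ∨-zeroʳ (at v x a b ∨ at x v a b)
position⇒usesEdge v x 7F {a} {b} {c} {d} h
  rewrite h | ∨-zeroʳ (at v x d a) | ∨-zeroʳ (at v x c d ∨ at x v c d) | ∨-zeroʳ (at v x b c ∨ at x v b c)
  = ∨-zeroʳ (at v x a b ∨ at x v a b)

module _ {n} (G : Graph n) where

  adj-sym : ∀ {x y} → Edge G x y → Edge G y x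
  adj-sym {x} {y} = trans (Graph.sym G y x)

  adj⇒≢ : ∀ {x y} → Edge G x y → ¬ x ≡ y
  adj⇒≢ {x} h refl rewrite irrefl G x = case h of λ ()

  isSquare : Fin n → Fin n → Fin n → Fin n → Bool
  isSquare a b c d = isCycleB G (a ∷ᵛ b ∷ᵛ c ∷ᵛ d ∷ᵛ []ᵛ)

  record Square (a b c d : Fin n) : Set where
    field
      ab  : Edge G a b
      bc  : Edge G b c
      cd  : Edge G c d
      da  : Edge G d a
      a≢c : ¬ a ≡ c
      b≢d : ¬ b ≡ d
  open Square

  isSquare⇒Square : ∀ {a b c d} → isSquare a b c d ≡ true → Square a b c d
  isSquare⇒Square {a} {b} {c} {d} h
    with ∧-true h
  ... | distinct , edges
    with allB-true (λ e → adj G (proj₁ e) (proj₂ e)) ((a , b) ∷ (b , c) ∷ (c , d) ∷ (d , a) ∷ []) edges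
       | ∧-true distinct
  ... | ab ∷ bc ∷ cd ∷ da ∷ [] | a-row , other-rows
    with allB-true (λ y → not (a == y)) (b ∷ c ∷ d ∷ []) a-row
       | allB-true (λ y → not (b == y)) (c ∷ d ∷ []) (proj₁ (∧-true other-rows))
  ... | _ ∷ a≢c ∷ _ ∷ [] | _ ∷ b≢d ∷ [] =
    record { ab = ab ; bc = bc ; cd = cd ; da = da ; a≢c = not-==⇒≢ a≢c ; b≢d = not-==⇒≢ b≢d }

  Square⇒isSquare : ∀ {a b c d} → Square a b c d → isSquare a b c d ≡ true
  Square⇒isSquare {a} {b} {c} {d} sq = cong₂ _∧_
    (cong₂ _∧_ (true-allB (λ y → not (a == y)) (distinct (ab sq) ∷ ≢⇒not-== (a≢c sq) ∷ distinct (adj-sym (da sq)) ∷ []))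
    (cong₂ _∧_ (true-allB (λ y → not (b == y)) (distinct (bc sq) ∷ ≢⇒not-== (b≢d sq) ∷ []))
    (cong₂ _∧_ (true-allB (λ y → not (c == y)) (distinct (cd sq) ∷ [])) refl)))
    (true-allB (λ e → adj G (proj₁ e) (proj₂ e)) (ab sq ∷ bc sq ∷ cd sq ∷ da sq ∷ []))
    where
    distinct : ∀ {x y} → Edge G x y → not (x == y) ≡ true
    distinct = ≢⇒not-== ∘ adj⇒≢

  Square-rotate : ∀ {a b c d} → Square a b c d → Square b c d a
  Square-rotate sq = record
    { ab = bc sq ; bc = cd sq ; cd = da sq ; da = ab sq ; a≢c = b≢d sq ; b≢d = a≢c sq ∘ sym }

  Square-reverse : ∀ {a b c d} → Square a b c d → Square d c b a
  Square-reverse sq = record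
    { ab = adj-sym (cd sq) ; bc = adj-sym (bc sq) ; cd = adj-sym (ab sq) ; da = adj-sym (da sq)
    ; a≢c = b≢d sq ∘ sym ; b≢d = a≢c sq ∘ sym }

  Square-occurrences-≤1 : ∀ {a b c d} → Square a b c d → ∀ v →
    ⟦ a == v ⟧ + (⟦ b == v ⟧ + (⟦ c == v ⟧ + ⟦ d == v ⟧)) ≤ 1
  Square-occurrences-≤1 {a} {b} {c} {d} sq v with a ≟ v
  ... | yes refl rewrite ==-false (adj⇒≢ (ab sq) ∘ sym) | ==-false (a≢c sq ∘ sym)
                       | ==-false (adj⇒≢ (da sq)) = s≤s z≤n
  ... | no _ with b ≟ v
  ...   | yes refl rewrite ==-false (adj⇒≢ (bc sq) ∘ sym) | ==-false (b≢d sq ∘ sym) = s≤s z≤n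
  ...   | no _ with c ≟ v
  ...     | yes refl rewrite ==-false (adj⇒≢ (cd sq) ∘ sym) = s≤s z≤n
  ...     | no _ = ⟦⟧≤1 (d == v)

  -- v and x each occur at most once, and the eight indicators are among the sixteen products
  -- of (∑ ⟦ · == v ⟧)(∑ ⟦ · == x ⟧).
  positions-≤1 : ∀ {a b c d} → Square a b c d → ∀ v x → ∑[ i < 8 ] ⟦ position v x i a b c d ⟧ ≤ 1
  positions-≤1 {a} {b} {c} {d} sq v x
    rewrite ⟦∧⟧ (a == v) (b == x) | ⟦∧⟧ (a == x) (b == v) | ⟦∧⟧ (b == v) (c == x) | ⟦∧⟧ (b == x) (c == v)
          | ⟦∧⟧ (c == v) (d == x) | ⟦∧⟧ (c == x) (d == v) | ⟦∧⟧ (d == v) (a == x) | ⟦∧⟧ (d == x) (a == v)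
    = ≤-trans (eight-products-≤ ⟦ a == v ⟧ ⟦ b == v ⟧ ⟦ c == v ⟧ ⟦ d == v ⟧ ⟦ a == x ⟧ ⟦ b == x ⟧ ⟦ c == x ⟧ ⟦ d == x ⟧)
              (*-mono-≤ (Square-occurrences-≤1 sq v) (Square-occurrences-≤1 sq x))

  positions-≤-usesEdge : ∀ v x a b c d →
    ∑[ i < 8 ] ⟦ isSquare a b c d ∧ position v x i a b c d ⟧
      ≤ ⟦ isSquare a b c d ∧ usesEdge (a ∷ᵛ b ∷ᵛ c ∷ᵛ d ∷ᵛ []ᵛ) v x ⟧
  positions-≤-usesEdge v x a b c d with isSquare a b c d in sq
  ... | false = z≤n
  ... | true  = at-most-one-≤-any (λ i → position v x i a b c d) _ (λ i → position⇒usesEdge v x i)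
                  (positions-≤1 (isSquare⇒Square {a} {b} {c} {d} sq) v x)

  -- Each 4-cycle through the edge vx is counted once, by its labelling v x p q.
  squaresOn : Fin n → Fin n → ℕ
  squaresOn v x = ∑[ p < n ] ∑[ q < n ] ⟦ isSquare v x p q ⟧

  isSquare-rotate : ∀ a b c d → isSquare a b c d ≡ true → isSquare b c d a ≡ true
  isSquare-rotate a b c d = Square⇒isSquare ∘ Square-rotate ∘ isSquare⇒Square {a} {b} {c} {d}

  isSquare-flip : ∀ a b c d → isSquare a b c d ≡ true → isSquare b a d c ≡ true
  isSquare-flip a b c d =
    Square⇒isSquare ∘ Square-rotate ∘ Square-rotate ∘ Square-reverse ∘ isSquare⇒Square {a} {b} {c} {d}

  squaresOn-sym : ∀ v x → squaresOn v x ≡ squaresOn x v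
  squaresOn-sym v x = trans (∑-comm λ p q → ⟦ isSquare v x p q ⟧)
    (sum-cong-≗ λ q → sum-cong-≗ λ p →
      ≤-antisym (⟦⟧-mono (isSquare-flip v x p q)) (⟦⟧-mono (isSquare-flip x v q p)))

  labelledSquaresAt : Fin n → Fin n → Fin 8 → ℕ
  labelledSquaresAt v x i = ∑⁴ λ a b c d → ⟦ isSquare a b c d ∧ position v x i a b c d ⟧

  module _ (s t : Fin n) where

    with-edge-first : ∀ {p} → p ≡ true → p ∧ at s t s t ≡ true
    with-edge-first h = cong₂ _∧_ h (cong₂ _∧_ (==-refl s) (==-refl t))

    squaresOn-≤-ab : squaresOn s t ≤ ∑⁴ λ a b c d → ⟦ isSquare a b c d ∧ at s t a b ⟧
    squaresOn-≤-ab = ≤-trans (≤-reflexive (∑-comm λ p q → ⟦ isSquare s t p q ⟧))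
      (≤-trans (sum-mono-≤ λ q → sum-mono-≤ λ p → ⟦⟧-mono (with-edge-first {isSquare s t p q})) (pick-ab _ s t))

    squaresOn-≤-bc : squaresOn s t ≤ ∑⁴ λ a b c d → ⟦ isSquare a b c d ∧ at s t b c ⟧
    squaresOn-≤-bc = ≤-trans (sum-mono-≤ λ p → sum-mono-≤ λ q → ⟦⟧-mono λ h →
        with-edge-first {isSquare q s t p} (isSquare-rotate p q s t (isSquare-rotate t p q s (isSquare-rotate s t p q h))))
      (pick-bc _ s t)

    squaresOn-≤-cd : squaresOn s t ≤ ∑⁴ λ a b c d → ⟦ isSquare a b c d ∧ at s t c d ⟧
    squaresOn-≤-cd = ≤-trans (≤-reflexive (∑-comm λ p q → ⟦ isSquare s t p q ⟧))
      (≤-trans (sum-mono-≤ λ q → sum-mono-≤ λ p → ⟦⟧-mono λ h →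
        with-edge-first {isSquare p q s t} (isSquare-rotate t p q s (isSquare-rotate s t p q h)))
      (pick-cd _ s t))

    squaresOn-≤-da : squaresOn s t ≤ ∑⁴ λ a b c d → ⟦ isSquare a b c d ∧ at s t d a ⟧
    squaresOn-≤-da = ≤-trans (≤-reflexive (∑-comm λ p q → ⟦ isSquare s t p q ⟧))
      (≤-trans (sum-mono-≤ λ q → sum-mono-≤ λ p → ⟦⟧-mono λ h → with-edge-first {isSquare t p q s} (isSquare-rotate s t p q h))
      (pick-da _ s t))

  squaresOn-≤-labelledSquaresAt : ∀ v x i → squaresOn v x ≤ labelledSquaresAt v x i
  squaresOn-≤-labelledSquaresAt v x 0F = squaresOn-≤-ab v x
  squaresOn-≤-labelledSquaresAt v x 1F = ≤-trans (≤-reflexive (squaresOn-sym v x)) (squaresOn-≤-ab x v)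
  squaresOn-≤-labelledSquaresAt v x 2F = squaresOn-≤-bc v x
  squaresOn-≤-labelledSquaresAt v x 3F = ≤-trans (≤-reflexive (squaresOn-sym v x)) (squaresOn-≤-bc x v)
  squaresOn-≤-labelledSquaresAt v x 4F = squaresOn-≤-cd v x
  squaresOn-≤-labelledSquaresAt v x 5F = ≤-trans (≤-reflexive (squaresOn-sym v x)) (squaresOn-≤-cd x v)
  squaresOn-≤-labelledSquaresAt v x 6F = squaresOn-≤-da v x
  squaresOn-≤-labelledSquaresAt v x 7F = ≤-trans (≤-reflexive (squaresOn-sym v x)) (squaresOn-≤-da x v)

  8*squaresOn≤labelledCycles : ∀ v x → 8 * squaresOn v x ≤ labelledCyclesThrough G 4 v x
  8*squaresOn≤labelledCycles v x = begin
    8 * squaresOn v x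
      ≤⟨ sum-mono-≤ (squaresOn-≤-labelledSquaresAt v x) ⟩
    ∑[ i < 8 ] labelledSquaresAt v x i
      ≡⟨ ∑-∑⁴-comm (λ i a b c d → ⟦ isSquare a b c d ∧ position v x i a b c d ⟧) ⟩
    ∑⁴ (λ a b c d → ∑[ i < 8 ] ⟦ isSquare a b c d ∧ position v x i a b c d ⟧)
      ≤⟨ ∑⁴-mono-≤ (positions-≤-usesEdge v x) ⟩
    ∑⁴ (λ a b c d → ⟦ isSquare a b c d ∧ usesEdge (a ∷ᵛ b ∷ᵛ c ∷ᵛ d ∷ᵛ []ᵛ) v x ⟧)
      ≡⟨ countB-allVecs n 4 (λ c → isCycleB G c ∧ usesEdge c v x) ⟨
    labelledCyclesThrough G 4 v x ∎
    where open ≤-Reasoning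

  squaresOn-≤ : ∀ {l} → EdgeInCycles G 4 l → ∀ v x → squaresOn v x ≤ l * ⟦ adj G v x ⟧
  squaresOn-≤ {l} cycles v x = by-adjacency (adj G v x) refl
    where
    by-adjacency : ∀ b → adj G v x ≡ b → squaresOn v x ≤ l * ⟦ b ⟧
    by-adjacency true vx = ≤-trans
      (*-cancelˡ-≤ 8 (≤-trans (8*squaresOn≤labelledCycles v x) (≤-reflexive (cycles v x vx))))
      (≤-reflexive (sym (*-identityʳ l)))
    by-adjacency false vx = ≤-trans
      (sum-mono-≤ λ p → sum-mono-≤ λ q → ⟦⟧-mono {isSquare v x p q} λ h →
        trans (sym vx) (Square.ab (isSquare⇒Square {v} {x} {p} {q} h)))
      (≤-reflexive (trans (sum-zero² n n) (sym (*-zeroʳ l))))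

module _ {n} (G : Graph n) {r l : ℕ} (regular : Regular G (suc r)) (cycles : EdgeInCycles G 4 l) (v : Fin n) where

  degree-sum : ∀ y → ∑[ x < n ] ⟦ adj G y x ⟧ ≡ suc r
  degree-sum y = trans (sym (countB-allFin (adj G y))) (regular y)

  path : Fin n → Fin n → Bool
  path x w = adj G v x ∧ (adj G x w ∧ not (w == v))

  codegree : Fin n → ℕ
  codegree w = ∑[ x < n ] ⟦ path x w ⟧

  onward-degree : ∀ {x} → Edge G v x → ∑[ w < n ] ⟦ adj G x w ∧ not (w == v) ⟧ ≡ r
  onward-degree {x} vx = suc-injective (begin
    suc onward             ≡⟨ +-comm 1 onward ⟩
    onward + 1             ≡⟨ cong (λ b → onward + ⟦ b ⟧) (adj-sym G vx) ⟨
    onward + ⟦ adj G x v ⟧ ≡⟨ sum-split-at (adj G x) v ⟨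
    ∑[ w < n ] ⟦ adj G x w ⟧ ≡⟨ degree-sum x ⟩
    suc r                  ∎)
    where
    open ≡-Reasoning
    onward = ∑[ w < n ] ⟦ adj G x w ∧ not (w == v) ⟧

  sum-codegree : ∑[ w < n ] codegree w ≡ r * suc r
  sum-codegree = begin
    ∑[ w < n ] ∑[ x < n ] ⟦ path x w ⟧
      ≡⟨ ∑-comm (λ x w → ⟦ path x w ⟧) ⟨
    ∑[ x < n ] ∑[ w < n ] ⟦ path x w ⟧
      ≡⟨ sum-cong-≗ (λ x → trans (sum-cong-≗ (λ w → ⟦∧⟧ (adj G v x) (adj G x w ∧ not (w == v))))
                                 (sym (*-distribˡ-sum ⟦ adj G v x ⟧ (λ w → ⟦ adj G x w ∧ not (w == v) ⟧)))) ⟩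
    ∑[ x < n ] (⟦ adj G v x ⟧ * ∑[ w < n ] ⟦ adj G x w ∧ not (w == v) ⟧)
      ≡⟨ sum-cong-≗ (λ x → onward x (adj G v x) refl) ⟩
    ∑[ x < n ] (⟦ adj G v x ⟧ * r)
      ≡⟨ *-distribʳ-sum r (λ x → ⟦ adj G v x ⟧) ⟨
    ∑[ x < n ] ⟦ adj G v x ⟧ * r
      ≡⟨ cong (_* r) (degree-sum v) ⟩
    suc r * r
      ≡⟨ *-comm (suc r) r ⟩
    r * suc r ∎
    where
    open ≡-Reasoning
    onward : ∀ x b → adj G v x ≡ b → ⟦ b ⟧ * ∑[ w < n ] ⟦ adj G x w ∧ not (w == v) ⟧ ≡ ⟦ b ⟧ * r
    onward x true  vx = cong (1 *_) (onward-degree vx)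
    onward x false _  = refl

  path⇒edges : ∀ {x w} → path x w ≡ true → Edge G v x × Edge G x w × ¬ w ≡ v
  path⇒edges {x} {w} vxw = proj₁ (∧-true vxw) , proj₁ xw , not-==⇒≢ (proj₂ xw)
    where
    xw = ∧-true {adj G x w} (proj₂ (∧-true {adj G v x} vxw))

  paths⇒isSquare : ∀ {x y w} → path x w ≡ true → path y w ≡ true → ¬ y ≡ x → isSquare G v x w y ≡ true
  paths⇒isSquare {x} {y} {w} vxw vyw y≢x with path⇒edges vxw | path⇒edges vyw
  ... | vx , xw , w≢v | vy , yw , _ = Square⇒isSquare G {v} {x} {w} {y} record
    { ab = vx ; bc = xw ; cd = adj-sym G yw ; da = adj-sym G vy ; a≢c = w≢v ∘ sym ; b≢d = y≢x ∘ sym }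

  path-pair-≤ : ∀ x y w → ⟦ path x w ⟧ * ⟦ path y w ⟧ ≤ ⟦ y == x ⟧ * ⟦ path x w ⟧ + ⟦ isSquare G v x w y ⟧
  path-pair-≤ x y w = ⟦⟧*⟦⟧-≤ (path x w) (path y w) two-paths
    where
    two-paths : path x w ≡ true → path y w ≡ true → 1 ≤ ⟦ y == x ⟧ * ⟦ path x w ⟧ + ⟦ isSquare G v x w y ⟧
    two-paths vxw vyw with y ≟ x
    ... | yes refl rewrite vxw = s≤s z≤n
    ... | no y≢x rewrite paths⇒isSquare vxw vyw y≢x = ≤-refl

  codegree²-≤ : ∀ w → codegree w * codegree w ≤ codegree w + ∑[ x < n ] ∑[ y < n ] ⟦ isSquare G v x w y ⟧
  codegree²-≤ w = begin
    codegree w * codegree w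
      ≡⟨ *-distribʳ-sum (codegree w) (λ x → ⟦ path x w ⟧) ⟩
    ∑[ x < n ] (⟦ path x w ⟧ * codegree w)
      ≡⟨ sum-cong-≗ (λ x → *-distribˡ-sum ⟦ path x w ⟧ (λ y → ⟦ path y w ⟧)) ⟩
    ∑[ x < n ] ∑[ y < n ] (⟦ path x w ⟧ * ⟦ path y w ⟧)
      ≤⟨ sum-mono-≤ (λ x → sum-mono-≤ (λ y → path-pair-≤ x y w)) ⟩
    ∑[ x < n ] ∑[ y < n ] (⟦ y == x ⟧ * ⟦ path x w ⟧ + ⟦ isSquare G v x w y ⟧)
      ≡⟨ sum-cong-≗ (λ x → trans (∑-distrib-+ (λ y → ⟦ y == x ⟧ * ⟦ path x w ⟧) (λ y → ⟦ isSquare G v x w y ⟧))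
                                 (cong (_+ ∑[ y < n ] ⟦ isSquare G v x w y ⟧) (sum-at (λ _ → ⟦ path x w ⟧) x))) ⟩
    ∑[ x < n ] (⟦ path x w ⟧ + ∑[ y < n ] ⟦ isSquare G v x w y ⟧)
      ≡⟨ ∑-distrib-+ (λ x → ⟦ path x w ⟧) (λ x → ∑[ y < n ] ⟦ isSquare G v x w y ⟧) ⟩
    codegree w + ∑[ x < n ] ∑[ y < n ] ⟦ isSquare G v x w y ⟧ ∎
    where open ≤-Reasoning

  sum-codegree²-≤ : ∑[ w < n ] (codegree w * codegree w) ≤ r * suc r + l * suc r
  sum-codegree²-≤ = begin
    ∑[ w < n ] (codegree w * codegree w)
      ≤⟨ sum-mono-≤ codegree²-≤ ⟩
    ∑[ w < n ] (codegree w + ∑[ x < n ] ∑[ y < n ] ⟦ isSquare G v x w y ⟧)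
      ≡⟨ ∑-distrib-+ codegree (λ w → ∑[ x < n ] ∑[ y < n ] ⟦ isSquare G v x w y ⟧) ⟩
    ∑[ w < n ] codegree w + ∑[ w < n ] ∑[ x < n ] ∑[ y < n ] ⟦ isSquare G v x w y ⟧
      ≡⟨ cong₂ _+_ sum-codegree (∑-comm (λ w x → ∑[ y < n ] ⟦ isSquare G v x w y ⟧)) ⟩
    r * suc r + ∑[ x < n ] squaresOn G v x
      ≤⟨ +-monoʳ-≤ (r * suc r) (sum-mono-≤ (squaresOn-≤ G {l} cycles v)) ⟩
    r * suc r + ∑[ x < n ] (l * ⟦ adj G v x ⟧)
      ≡⟨ cong (r * suc r +_) (trans (sym (*-distribˡ-sum l (λ x → ⟦ adj G v x ⟧))) (cong (l *_) (degree-sum v))) ⟩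
    r * suc r + l * suc r ∎
    where open ≤-Reasoning

  ball-bound : (P : Fin n → Bool) → (∀ {x w} → Edge G v x → Edge G x w → P w ≡ true) →
    r * r * suc r ≤ ∑[ w < n ] ⟦ P w ∧ not (w == v) ⟧ * (r + l)
  ball-bound P P-two-steps = *-cancelˡ-≤ (suc r) (subst₂ _≤_ (square r) (regroup r l m) (begin
    r * suc r * (r * suc r)
      ≡⟨ cong (λ s → s * s) sum-codegree ⟨
    ∑[ w < n ] codegree w * ∑[ w < n ] codegree w
      ≤⟨ cauchy-schwarz codegree ball supported ⟩
    m * ∑[ w < n ] (codegree w * codegree w)
      ≤⟨ *-monoʳ-≤ m sum-codegree²-≤ ⟩
    m * (r * suc r + l * suc r) ∎))
    where
    open ≤-Reasoning
    ball : Fin n → Bool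
    ball w = P w ∧ not (w == v)
    m = ∑[ w < n ] ⟦ ball w ⟧
    supported : Supported codegree ball
    supported w outside = n≤0⇒n≡0 (≤-trans
      (sum-mono-≤ λ x → ⟦⟧-mono {path x w} λ vxw → trans (sym outside) (inside vxw))
      (≤-reflexive (sum-replicate-zero n)))
      where
      inside : ∀ {x} → path x w ≡ true → ball w ≡ true
      inside vxw with path⇒edges vxw
      ... | vx , xw , w≢v = cong₂ _∧_ (P-two-steps vx xw) (≢⇒not-== w≢v)
    square : ∀ r → r * suc r * (r * suc r) ≡ suc r * (r * r * suc r)
    square = solve-∀
    regroup : ∀ r l m → m * (r * suc r + l * suc r) ≡ suc r * (m * (r + l))
    regroup = solve-∀

-- With k = r + 1, r³ + r² + r + λ = k³ − 2k² + 2k − 1 + λ and λ + r = λ + k − 1.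
egr-order-bound : ∀ {n} (G : Graph n) {r l} → IsEGR G (suc r) 4 l → r * r * r + r * r + r + l ≤ (l + r) * n
egr-order-bound {n} G {r} {l} (regular , ((_ , (v ∷ᵛ _) , _) , _) , cycles) = begin
  r * r * r + r * r + r + l ≡⟨ regroup r l ⟩
  r * r * suc r + (r + l)   ≤⟨ +-monoˡ-≤ (r + l) (ball-bound G regular cycles v (λ _ → true) (λ _ _ → refl)) ⟩
  m * (r + l) + (r + l)     ≡⟨ expand r l m ⟩
  (l + r) * suc m           ≡⟨ cong ((l + r) *_) order ⟨
  (l + r) * n               ∎
  where
  open ≤-Reasoning
  m = ∑[ w < n ] ⟦ not (w == v) ⟧
  order : n ≡ suc m
  order = trans (sym (sum-ones n)) (trans (sum-split-at (λ _ → true) v) (+-comm m 1))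
  regroup : ∀ r l → r * r * r + r * r + r + l ≡ r * r * suc r + (r + l)
  regroup = solve-∀
  expand : ∀ r l m → m * (r + l) + (r + l) ≡ (l + r) * suc m
  expand = solve-∀

sameColour : Bool → Bool → Bool
sameColour c c′ = not (c xor c′)

sameColour-refl : ∀ c → sameColour c c ≡ true
sameColour-refl true  = refl
sameColour-refl false = refl

sameColour-two-steps : ∀ {c c′ c″} → ¬ c ≡ c′ → ¬ c′ ≡ c″ → sameColour c″ c ≡ true
sameColour-two-steps {true}  {true}          c≢c′ _     = contradiction refl c≢c′
sameColour-two-steps {false} {false}         c≢c′ _     = contradiction refl c≢c′
sameColour-two-steps {true}  {false} {false} _    c′≢c″ = contradiction refl c′≢c″
sameColour-two-steps {false} {true}  {true}  _    c′≢c″ = contradiction refl c′≢c″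
sameColour-two-steps {true}  {false} {true}  _    _     = refl
sameColour-two-steps {false} {true}  {false} _    _     = refl

sameColour-partition : ∀ {c c′} → ¬ c ≡ c′ → ∀ c″ → ⟦ sameColour c″ c ⟧ + ⟦ sameColour c″ c′ ⟧ ≡ 1
sameColour-partition {true}  {true}  c≢c′ _     = contradiction refl c≢c′
sameColour-partition {false} {false} c≢c′ _     = contradiction refl c≢c′
sameColour-partition {true}  {false} _    true  = refl
sameColour-partition {true}  {false} _    false = refl
sameColour-partition {false} {true}  _    true  = refl
sameColour-partition {false} {true}  _    false = refl

bipartite-egr-order-bound : ∀ {n} (G : Graph n) {r l} → IsBipartite G → IsEGR G (suc r) 4 l →
  2 * (r * r * r + r * r + r + l) ≤ (l + r) * n
bipartite-egr-order-bound {n} G {r} {l} (colour , proper)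
                          (regular , ((_ , (a ∷ᵛ b ∷ᵛ c ∷ᵛ d ∷ᵛ []ᵛ) , abcd) , _) , cycles) = begin
  2 * (r * r * r + r * r + r + l)                 ≡⟨ regroup r l ⟩
  r * r * suc r + r * r * suc r + 2 * (r + l)     ≤⟨ +-monoˡ-≤ (2 * (r + l)) (+-mono-≤ (side a) (side b)) ⟩
  mₐ * (r + l) + m_b * (r + l) + 2 * (r + l)      ≡⟨ expand r l mₐ m_b ⟩
  (l + r) * (suc mₐ + suc m_b)                    ≡⟨ cong ((l + r) *_) order ⟨
  (l + r) * n                                     ∎
  where
  open ≤-Reasoning
  class : Fin n → Fin n → Bool
  class v w = sameColour (colour w) (colour v)
  size : Fin n → ℕ
  size v = ∑[ w < n ] ⟦ class v w ∧ not (w == v) ⟧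
  mₐ = size a
  m_b = size b
  side : ∀ v → r * r * suc r ≤ size v * (r + l)
  side v = ball-bound G regular cycles v (class v) λ vx xw → sameColour-two-steps (proper _ _ vx) (proper _ _ xw)
  class-size : ∀ v → ∑[ w < n ] ⟦ class v w ⟧ ≡ suc (size v)
  class-size v = trans (sum-split-at (class v) v)
                       (trans (cong (λ c → size v + ⟦ c ⟧) (sameColour-refl (colour v))) (+-comm (size v) 1))
  ab : Edge G a b
  ab = Square.ab (isSquare⇒Square G {a} {b} {c} {d} abcd)
  order : n ≡ suc mₐ + suc m_b
  order = begin-equality
    n                                                  ≡⟨ sum-ones n ⟨
    ∑[ w < n ] 1                                       ≡⟨ sum-cong-≗ (λ w → sameColour-partition (proper a b ab) (colour w)) ⟨
    ∑[ w < n ] (⟦ class a w ⟧ + ⟦ class b w ⟧)         ≡⟨ ∑-distrib-+ (λ w → ⟦ class a w ⟧) (λ w → ⟦ class b w ⟧) ⟩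
    ∑[ w < n ] ⟦ class a w ⟧ + ∑[ w < n ] ⟦ class b w ⟧ ≡⟨ cong₂ _+_ (class-size a) (class-size b) ⟩
    suc mₐ + suc m_b                                   ∎
  regroup : ∀ r l → 2 * (r * r * r + r * r + r + l) ≡ r * r * suc r + r * r * suc r + 2 * (r + l)
  regroup = solve-∀
  expand : ∀ r l mₐ m_b → mₐ * (r + l) + m_b * (r + l) + 2 * (r + l) ≡ (l + r) * (suc mₐ + suc m_b)
  expand = solve-∀

open import Data.Integer using (ℤ; +_; -_; _-_; +≤+) renaming (_*_ to _*ℤ_; _+_ to _+ℤ_; _≤_ to _≤ℤ_; _^_ to _^ℤ_)
import Data.Integer.Properties as ℤ
import Data.Integer.Tactic.RingSolver as ℤ-Solver

numerator-≡ : ∀ r l →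
  ((+ suc r) ^ℤ 3) - (+ 2) *ℤ ((+ suc r) ^ℤ 2) +ℤ (+ 2) *ℤ (+ suc r) - (+ 1) +ℤ (+ l)
    ≡ + (r * r * r + r * r + r + l)
numerator-≡ r l = trans (expand (+ r) (+ l)) (sym cast)
  where
  expand : ∀ J L → (+ 1 +ℤ J) *ℤ ((+ 1 +ℤ J) *ℤ ((+ 1 +ℤ J) *ℤ + 1)) +ℤ - ((+ 2) *ℤ ((+ 1 +ℤ J) *ℤ ((+ 1 +ℤ J) *ℤ + 1)))
                     +ℤ (+ 2) *ℤ (+ 1 +ℤ J) +ℤ - (+ 1) +ℤ L
                     ≡ J *ℤ J *ℤ J +ℤ J *ℤ J +ℤ J +ℤ L
  expand = ℤ-Solver.solve-∀
  cast : + (r * r * r + r * r + r + l) ≡ (+ r) *ℤ (+ r) *ℤ (+ r) +ℤ (+ r) *ℤ (+ r) +ℤ (+ r) +ℤ (+ l)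
  cast = trans (ℤ.pos-+ _ l) (cong (_+ℤ + l)
         (trans (ℤ.pos-+ _ r) (cong (_+ℤ + r)
         (trans (ℤ.pos-+ _ (r * r)) (cong₂ _+ℤ_ (trans (ℤ.pos-* (r * r) r) (cong (_*ℤ + r) (ℤ.pos-* r r)))
                                                (ℤ.pos-* r r))))))

denominator-≡ : ∀ r l → (+ l) +ℤ (+ suc r) - (+ 1) ≡ + (l + r)
denominator-≡ r l = trans (expand (+ l) (+ r)) (sym (ℤ.pos-+ l r))
  where
  expand : ∀ L J → L +ℤ (+ 1 +ℤ J) +ℤ - (+ 1) ≡ L +ℤ J
  expand = ℤ-Solver.solve-∀

module _ (r l n : ℕ) where

  bound-in-ℤ : r * r * r + r * r + r + l ≤ (l + r) * n →
    ((+ suc r) ^ℤ 3) - (+ 2) *ℤ ((+ suc r) ^ℤ 2) +ℤ (+ 2) *ℤ (+ suc r) - (+ 1) +ℤ (+ l)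
      ≤ℤ ((+ l) +ℤ (+ suc r) - (+ 1)) *ℤ (+ n)
  bound-in-ℤ h rewrite numerator-≡ r l | denominator-≡ r l | sym (ℤ.pos-* (l + r) n) = +≤+ h

  double-bound-in-ℤ : 2 * (r * r * r + r * r + r + l) ≤ (l + r) * n →
    (+ 2) *ℤ (((+ suc r) ^ℤ 3) - (+ 2) *ℤ ((+ suc r) ^ℤ 2) +ℤ (+ 2) *ℤ (+ suc r) - (+ 1) +ℤ (+ l))
      ≤ℤ ((+ l) +ℤ (+ suc r) - (+ 1)) *ℤ (+ n)
  double-bound-in-ℤ h rewrite numerator-≡ r l | denominator-≡ r l | sym (ℤ.pos-* (l + r) n)
                            | sym (ℤ.pos-* 2 (r * r * r + r * r + r + l)) = +≤+ h

mainTheorem6 : (k l : ℕ) → 3 ≤ k → 1 ≤ l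
    → (∀ {n} (G : Graph n) → IsExtremalEGR G k 4 l
    → ((+ k) ^ℤ 3) - (+ 2) *ℤ ((+ k) ^ℤ 2) +ℤ (+ 2) *ℤ (+ k) - (+ 1) +ℤ (+ l)
    ≤ℤ ((+ l) +ℤ (+ k) - (+ 1)) *ℤ (+ n))
    × (∀ {n} (G : Graph n) → IsExtremalBipEGR G k 4 l
    → (+ 2) *ℤ (((+ k) ^ℤ 3) - (+ 2) *ℤ ((+ k) ^ℤ 2) +ℤ (+ 2) *ℤ (+ k) - (+ 1) +ℤ (+ l))
    ≤ℤ ((+ l) +ℤ (+ k) - (+ 1)) *ℤ (+ n))
mainTheorem6 (suc r) l _ _ =
  (λ {n} G extremal → bound-in-ℤ r l n (egr-order-bound G (proj₁ extremal))) ,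
  (λ {n} G extremal → double-bound-in-ℤ r l n
                        (bipartite-egr-order-bound G (proj₁ (proj₁ extremal)) (proj₂ (proj₁ extremal))))
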